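{- Let $n\ge 0$ and $k\ge 0$ be integers. Then $$ m_{2^k}\big(\mathrm{Im}\mathcal B_2(n)\big)=\sum_{i=0}^{\lfloor k/2\rfloor}\big|\mathcal{BR}_{2^i,2^{k-i}}(n)\big|. $$
   Context: A partition of $n$ is a weakly decreasing sequence $\lambda=(\lambda_1,\dots,\lambda_\ell)$ of positive integers with sum $n$; $\ell=\ell(\lambda)$ is its length. A binary partition is a partition all of whose parts are powers of $2$ (including $1=2^0$). Let $\mathcal B(n)$ be the set of binary partitions of $n$ and $\mathcal B_2(n)$ the set of those with at least $2$ parts. For a partition $\lambda$ with $\ell(\lambda)\ge 2$, $\mathrm{pre}_2(\lambda)$ is the partition whose parts are the $\binom{\ell}{2}$ products $\lambda_i\lambda_j$, $1\le i<j\le \ell$ (i.e. the summands of $e_2(\lambda_1,\dots,\lambda_\ell)$), sorted in decreasing order. Let $\mathrm{Im}\mathcal B_2(n)=\{\mathrm{pre}_2(\lambda):\lambda\in\mathcal B_2(n)\}$. For a partition $\mu$ and positive integer $i$, $m_i(\mu)$ is the number of parts of $\mu$ equal to $i$, and for a finite set $S$ of partitions $m_i(S)=\sum_{\mu\in S}m_i(\mu)$. For positive integers $e,f$, $\mathcal{BR}_{e,f}(n)$ is the set of rooted binary partitions of $n$ with exactly two roots of values $e$ and $f$: formally, the set of pairs $(\lambda,\{p,q\})$ with $\lambda\in\mathcal B(n)$ and $\{p,q\}$ a $2$-element subset of positions $\{1,\dots,\ell(\lambda)\}$ such that $\{\lambda_p,\lambda_q\}=\{e,f\}$ as multisets. (So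 $|\mathcal{BR}_{e,f}(n)|=\sum_{\lambda\in\mathcal B(n)} m_e(\lambda)m_f(\lambda)$ if $e\ne f$ and $\sum_{\lambda\in\mathcal B(n)}\binom{m_e(\lambda)}{2}$ if $e=f$.) -}

module Defs where

open import Data.Nat using (ℕ; zero; suc; _+_; _*_; _^_; _≤_; _≥_; _<_; _≟_; ⌊_/2⌋)
open import Data.Nat.Properties using (≤-decTotalOrder)
open import Data.List using (List; []; _∷_; map; _++_; length; filter; upTo)
open import Data.Nat.ListAction using (sum)
open import Data.List.Relation.Unary.All using (All)
open import Data.List.Relation.Unary.Linked using (Linked)
open import Data.List.Relation.Unary.Unique.Propositional using (Unique)
open import Data.List.Membership.Propositional using (_∈_)
open import Data.Product using (_×_; _,_; ∃; Σ)
open import Data.Sum using (_⊎_)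
open import Relation.Binary.PropositionalEquality using (_≡_)
open import Relation.Nullary using (Dec; yes; no)
open import Relation.Nullary.Decidable using (_×-dec_; _⊎-dec_)
open import Function.Bundles using (_⇔_)
import Relation.Binary.Construct.Flip.EqAndOrd as Flip
import Data.List.Sort.InsertionSort.Base as ISort

IsPartition : ℕ → List ℕ → Set
IsPartition n λs = Linked _≥_ λs × All (λ x → 1 ≤ x) λs × sum λs ≡ n

IsPow2 : ℕ → Set
IsPow2 x = ∃ λ j → x ≡ 2 ^ j

IsBinPartition : ℕ → List ℕ → Set
IsBinPartition n λs = IsPartition n λs × All IsPow2 λs

sortDesc : List ℕ → List ℕ
sortDesc = ISort.sort (Flip.decTotalOrder ≤-decTotalOrder)

pairProducts : List ℕ → List ℕ
pairProducts [] = []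
pairProducts (x ∷ xs) = map (x *_) xs ++ pairProducts xs

pre2 : List ℕ → List ℕ
pre2 λs = sortDesc (pairProducts λs)

InImB2 : ℕ → List ℕ → Set
InImB2 n μ = Σ (List ℕ) λ λs → IsBinPartition n λs × 2 ≤ length λs × pre2 λs ≡ μ

mult : ℕ → List ℕ → ℕ
mult i μ = length (filter (_≟ i) μ)

-- A duplicate-free list enumerating exactly the elements satisfying P
-- (i.e. a list representation of the finite set {x | P x}).
Enumerates : {A : Set} → (A → Set) → List A → Set
Enumerates {A} P L = Unique L × ((x : A) → (x ∈ L) ⇔ P x)

posPairs : List ℕ → List (ℕ × ℕ)
posPairs [] = []
posPairs (x ∷ xs) = map (x ,_) xs ++ posPairs xs

RootMatch : ℕ → ℕ → ℕ × ℕ → Set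
RootMatch e f (a , b) = (a ≡ e × b ≡ f) ⊎ (a ≡ f × b ≡ e)

rootMatch? : (e f : ℕ) → (ab : ℕ × ℕ) → Dec (RootMatch e f ab)
rootMatch? e f (a , b) = ((a ≟ e) ×-dec (b ≟ f)) ⊎-dec ((a ≟ f) ×-dec (b ≟ e))

rootCount : ℕ → ℕ → List ℕ → ℕ
rootCount e f λs = length (filter (rootMatch? e f) (posPairs λs))

sumTo : ℕ → (ℕ → ℕ) → ℕ
sumTo m g = sum (map g (upTo (suc m)))

-- A pair of parts 2^p, 2^q of λ contributes a part 2^k to pre₂(λ) exactly when p + q = k, and
-- then it is counted by exactly one root pair {2^i, 2^(k-i)} with i ≤ ⌊k/2⌋, namely i = min(p, q).
-- This proves the identity for each λ separately; summing over B₂(n) gives the theorem because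
-- pre₂ is injective on B(n). For injectivity, the identity (Σ x)² = Σ x² + 2 e₂, together with
-- the fact that the pairwise products of the squares are the squares of the pairwise products,
-- shows that n and the multiset pre₂(λ) determine every power sum Σ x^(2^m); and for decreasing
-- lists of powers of two a larger head part would dominate these power sums.

module Submission where

open import Defs
open import Data.Bool using (if_then_else_)
open import Data.Empty using (⊥-elim)
open import Data.List using (List; []; _∷_; map; _++_; length; filter; upTo; applyUpTo)
open import Data.List.Properties
  using (map-++; map-∘; map-cong; map-cong-local; map-id; map-upTo)
open import Data.List.Membership.Propositional using (_∈_)
open import Data.List.Membership.Propositional.Properties
  using (∈-map⁺; ∈-map⁻; ∈-filter⁺; ∈-filter⁻)
open import Data.List.Membership.Propositional.Properties.WithK using (unique∧set⇒bag)
open import Data.List.Relation.Binary.BagAndSetEquality using (∼bag⇒↭)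
open import Data.List.Relation.Binary.Permutation.Propositional using (_↭_; ↭-sym; ↭-trans)
import Data.List.Relation.Binary.Permutation.Propositional.Properties as Perm
open import Data.List.Relation.Unary.All as All using (All; []; _∷_)
import Data.List.Relation.Unary.All.Properties as Allₚ
open import Data.List.Relation.Unary.AllPairs using ([]; _∷_)
open import Data.List.Relation.Unary.Linked as Linked using (Linked)
open import Data.List.Relation.Unary.Linked.Properties using (Linked⇒All)
open import Data.List.Relation.Unary.Unique.Propositional using (Unique)
import Data.List.Relation.Unary.Unique.Propositional.Properties as Uniqueₚ
import Data.List.Sort.InsertionSort.Properties as InsertionSort
open import Data.Nat
  using ( ℕ; zero; suc; _+_; _*_; _^_; _∸_; _⊓_; _≤_; _<_; _≥_; _≟_; _≤?_; ⌊_/2⌋; ⌈_/2⌉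
        ; NonZero; z≤n; s≤s; z<s; s<s)
open import Data.Nat.ListAction using (sum)
open import Data.Nat.ListAction.Properties using (sum-++; sum-↭)
open import Data.Nat.Logarithm using (⌊log₂_⌋; ⌊log₂[2^n]⌋≡n)
open import Data.Nat.Properties
open import Algebra.Properties.CommutativeSemigroup +-commutativeSemigroup
  using () renaming (interchange to +-interchange)
open import Algebra.Properties.CommutativeSemigroup *-commutativeSemigroup
  using () renaming (interchange to *-interchange)
open import Data.Nat.Tactic.RingSolver using (solve-∀)
open import Data.Product using (_×_; _,_; proj₁; proj₂; uncurry)
open import Data.Sum using (inj₁; inj₂)
open import Function using (_∘_; id; flip)
open import Function.Bundles using (Equivalence; _⇔_; mk⇔)
open import Relation.Binary.PropositionalEquality
open import Relation.Binary.Definitions using (tri<; tri≈; tri>)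
import Relation.Binary.Construct.Flip.EqAndOrd as Flip
open import Relation.Nullary using (Dec; does; yes; no; ¬_)
open import Relation.Unary using (Decidable)

sum-zero : ∀ {xs} → All (_≡ 0) xs → sum xs ≡ 0
sum-zero []          = refl
sum-zero (refl ∷ zs) = sum-zero zs

sum-map-*ˡ : ∀ x ys → sum (map (x *_) ys) ≡ x * sum ys
sum-map-*ˡ x []       = sym (*-zeroʳ x)
sum-map-*ˡ x (y ∷ ys) =
  trans (cong (x * y +_) (sum-map-*ˡ x ys)) (sym (*-distribˡ-+ x y (sum ys)))

sum-map-+ : ∀ {A : Set} (f g : A → ℕ) xs →
            sum (map (λ x → f x + g x) xs) ≡ sum (map f xs) + sum (map g xs)
sum-map-+ f g []       = refl
sum-map-+ f g (x ∷ xs) =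
  trans (cong (f x + g x +_) (sum-map-+ f g xs)) (+-interchange (f x) (g x) _ _)

sum-map-comm : ∀ {A B : Set} (G : A → B → ℕ) as bs →
               sum (map (λ a → sum (map (G a) bs)) as)
                 ≡ sum (map (λ b → sum (map (λ a → G a b) as)) bs)
sum-map-comm G []       bs = sym (sum-zero (Allₚ.map⁺ (All.universal (λ _ → refl) bs)))
sum-map-comm G (a ∷ as) bs =
  trans (cong (sum (map (G a) bs) +_) (sum-map-comm G as bs)) (sym (sum-map-+ (G a) _ bs))

sum-map-filter : ∀ {A : Set} {P : A → Set} (P? : Decidable P) (f : A → ℕ) →
                 (∀ x → ¬ P x → f x ≡ 0) → ∀ xs → sum (map f (filter P? xs)) ≡ sum (map f xs)
sum-map-filter P? f f≡0 []       = refl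
sum-map-filter P? f f≡0 (x ∷ xs) with P? x
... | yes _  = cong (f x +_) (sum-map-filter P? f f≡0 xs)
... | no ¬px = trans (sum-map-filter P? f f≡0 xs) (cong (_+ sum (map f xs)) (sym (f≡0 x ¬px)))

Unique-map⁺-on : ∀ {A B : Set} {P : A → Set} (f : A → B) →
                 (∀ {x y} → P x → P y → f x ≡ f y → x ≡ y) →
                 ∀ {xs} → All P xs → Unique xs → Unique (map f xs)
Unique-map⁺-on f inj []         []           = []
Unique-map⁺-on f inj (px ∷ pxs) (x∉xs ∷ xs!) =
  Allₚ.map⁺ (All.zipWith (λ (py , x≢y) fx≡fy → x≢y (inj px py fx≡fy)) (pxs , x∉xs))
  ∷ Unique-map⁺-on f inj pxs xs!

Enumerates⇒All : ∀ {A : Set} {P : A → Set} {L} → Enumerates P L → All P L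
Enumerates⇒All (_ , ∈⇔P) = All.tabulate (Equivalence.to (∈⇔P _))

^-distrib-* : ∀ m n o → (m * n) ^ o ≡ m ^ o * n ^ o
^-distrib-* m n zero    = refl
^-distrib-* m n (suc o) = trans (cong (m * n *_) (^-distrib-* m n o)) (*-interchange m n _ _)

n<2^n : ∀ n → n < 2 ^ n
n<2^n zero    = z<s
n<2^n (suc n) = begin-strict
  suc n         ≡⟨ +-comm 1 n ⟩
  n + 1         <⟨ +-mono-<-≤ (n<2^n n) (m^n>0 2 n) ⟩
  2 ^ n + 2 ^ n ≡⟨ cong (2 ^ n +_) (sym (+-identityʳ (2 ^ n))) ⟩
  2 ^ suc n     ∎
  where open ≤-Reasoning

2^-injective : ∀ {a b} → 2 ^ a ≡ 2 ^ b → a ≡ b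
2^-injective {a} {b} eq =
  trans (sym (⌊log₂[2^n]⌋≡n a)) (trans (cong ⌊log₂_⌋ eq) (⌊log₂[2^n]⌋≡n b))

IsPow2⇒NonZero : ∀ {x} → IsPow2 x → NonZero x
IsPow2⇒NonZero (j , refl) = m^n≢0 2 j

IsPow2-<⇒2*≤ : ∀ {x y} → IsPow2 x → IsPow2 y → x < y → 2 * x ≤ y
IsPow2-<⇒2*≤ (a , refl) (b , refl) 2^a<2^b = ^-monoʳ-≤ 2 a<b
  where
  a<b : a < b
  a<b = ≰⇒> (λ b≤a → <⇒≱ 2^a<2^b (^-monoʳ-≤ 2 b≤a))

powerSum : ℕ → List ℕ → ℕ
powerSum e xs = sum (map (_^ e) xs)

powerSum-1 : ∀ xs → powerSum 1 xs ≡ sum xs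
powerSum-1 xs = cong sum (trans (map-cong ^-identityʳ xs) (map-id xs))

powerSum-map-^ : ∀ d e xs → powerSum e (map (_^ d) xs) ≡ powerSum (d * e) xs
powerSum-map-^ d e xs =
  cong sum (trans (sym (map-∘ xs)) (map-cong (λ x → ^-*-assoc x d e) xs))

powerSum-≤ : ∀ {x} e {zs} → All (_≤ x) zs → powerSum e zs ≤ length zs * x ^ e
powerSum-≤ e []           = z≤n
powerSum-≤ e (z≤x ∷ zs≤x) = +-mono-≤ (^-monoˡ-≤ e z≤x) (powerSum-≤ e zs≤x)

powerSum-∷-positive : ∀ {y} e ys → IsPow2 y → 0 < powerSum e (y ∷ ys)
powerSum-∷-positive {y} e ys py = ≤-trans (m^n>0 y {{IsPow2⇒NonZero py}} e) (m≤m+n _ _)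

-- With N = 2 ^ length zs we get length zs < 2 ^ N, so a head y ≥ 2 x alone outweighs zs.
powerSum-<-∷ : ∀ {x y} zs ys → .{{NonZero x}} → All (_≤ x) zs → 2 * x ≤ y →
               let N = 2 ^ length zs in powerSum N zs < powerSum N (y ∷ ys)
powerSum-<-∷ {x} {y} zs ys zs≤x 2x≤y = begin-strict
  powerSum N zs       ≤⟨ powerSum-≤ N zs≤x ⟩
  ℓ * x ^ N           <⟨ *-monoˡ-< (x ^ N) {{m^n≢0 x N}} ℓ<2^N ⟩
  2 ^ N * x ^ N       ≡⟨ ^-distrib-* 2 x N ⟨
  (2 * x) ^ N         ≤⟨ ^-monoˡ-≤ N 2x≤y ⟩
  y ^ N               ≤⟨ m≤m+n (y ^ N) (powerSum N ys) ⟩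
  powerSum N (y ∷ ys) ∎
  where
  open ≤-Reasoning
  ℓ = length zs
  N = 2 ^ ℓ
  ℓ<2^N : ℓ < 2 ^ N
  ℓ<2^N = <-trans (n<2^n ℓ) (n<2^n N)

smaller-head⇒smaller-powerSum : ∀ {x xs y ys} → Linked _≥_ (x ∷ xs) → IsPow2 x → IsPow2 y →
                                x < y → let N = 2 ^ length (x ∷ xs) in
                                powerSum N (x ∷ xs) < powerSum N (y ∷ ys)
smaller-head⇒smaller-powerSum {xs = xs} {ys = ys} ≥xs px py x<y =
  powerSum-<-∷ (_ ∷ xs) ys {{IsPow2⇒NonZero px}} (Linked⇒All (flip ≤-trans) ≤-refl ≥xs)
               (IsPow2-<⇒2*≤ px py x<y)

decreasing-pow2-powerSums-injective :
  ∀ {xs ys} → Linked _≥_ xs → Linked _≥_ ys → All IsPow2 xs → All IsPow2 ys →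
  (∀ m → powerSum (2 ^ m) xs ≡ powerSum (2 ^ m) ys) → xs ≡ ys
decreasing-pow2-powerSums-injective {[]}     {[]}     _ _ _ _ _ = refl
decreasing-pow2-powerSums-injective {[]}     {y ∷ ys} _ _ _ (py ∷ _) ps≡ =
  ⊥-elim (<⇒≢ (powerSum-∷-positive 1 ys py) (ps≡ 0))
decreasing-pow2-powerSums-injective {x ∷ xs} {[]}     _ _ (px ∷ _) _ ps≡ =
  ⊥-elim (<⇒≢ (powerSum-∷-positive 1 xs px) (sym (ps≡ 0)))
decreasing-pow2-powerSums-injective {x ∷ xs} {y ∷ ys} ≥xs ≥ys (px ∷ pxs) (py ∷ pys) ps≡
  with <-cmp x y
... | tri< x<y _ _ = ⊥-elim (<⇒≢ (smaller-head⇒smaller-powerSum {ys = ys} ≥xs px py x<y)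
                                  (ps≡ (length (x ∷ xs))))
... | tri> _ _ y<x = ⊥-elim (<⇒≢ (smaller-head⇒smaller-powerSum {ys = xs} ≥ys py px y<x)
                                  (sym (ps≡ (length (y ∷ ys)))))
... | tri≈ _ refl _ =
  cong (x ∷_) (decreasing-pow2-powerSums-injective (Linked.tail ≥xs) (Linked.tail ≥ys) pxs pys
                 (λ m → +-cancelˡ-≡ (x ^ 2 ^ m) _ _ (ps≡ m)))

sum-pairProducts-∷ : ∀ x xs → sum (pairProducts (x ∷ xs)) ≡ x * sum xs + sum (pairProducts xs)
sum-pairProducts-∷ x xs = trans (sum-++ (map (x *_) xs) (pairProducts xs))
                                (cong (_+ sum (pairProducts xs)) (sum-map-*ˡ x xs))

sum²≡powerSum-2+2*sum-pairProducts : ∀ xs →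
                                     sum xs ^ 2 ≡ powerSum 2 xs + 2 * sum (pairProducts xs)
sum²≡powerSum-2+2*sum-pairProducts []       = refl
sum²≡powerSum-2+2*sum-pairProducts (x ∷ xs) = begin
  (x + s) ^ 2                                    ≡⟨ expand x s ⟩
  x ^ 2 + s ^ 2 + 2 * (x * s)                    ≡⟨ cong (λ t → x ^ 2 + t + 2 * (x * s)) IH ⟩
  x ^ 2 + (powerSum 2 xs + 2 * e₂) + 2 * (x * s) ≡⟨ regroup (x ^ 2) (powerSum 2 xs) e₂ (x * s) ⟩
  x ^ 2 + powerSum 2 xs + 2 * (x * s + e₂)       ≡⟨ cong (λ t → x ^ 2 + powerSum 2 xs + 2 * t)
                                                         (sum-pairProducts-∷ x xs) ⟨
  powerSum 2 (x ∷ xs) + 2 * sum (pairProducts (x ∷ xs)) ∎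
  where
  open ≡-Reasoning
  s  = sum xs
  e₂ = sum (pairProducts xs)
  IH = sum²≡powerSum-2+2*sum-pairProducts xs
  expand : ∀ a b → (a + b) * ((a + b) * 1) ≡ a * (a * 1) + b * (b * 1) + 2 * (a * b)
  expand = solve-∀
  regroup : ∀ a b c d → a + (b + 2 * c) + 2 * d ≡ a + b + 2 * (d + c)
  regroup = solve-∀

pairProducts-map-^ : ∀ e xs → pairProducts (map (_^ e) xs) ≡ map (_^ e) (pairProducts xs)
pairProducts-map-^ e []       = refl
pairProducts-map-^ e (x ∷ xs) = begin
  map (x ^ e *_) (map (_^ e) xs) ++ pairProducts (map (_^ e) xs)
    ≡⟨ cong₂ _++_ products-of-powers (pairProducts-map-^ e xs) ⟩
  map (_^ e) (map (x *_) xs) ++ map (_^ e) (pairProducts xs)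
    ≡⟨ map-++ (_^ e) (map (x *_) xs) (pairProducts xs) ⟨
  map (_^ e) (pairProducts (x ∷ xs)) ∎
  where
  open ≡-Reasoning
  products-of-powers : map (x ^ e *_) (map (_^ e) xs) ≡ map (_^ e) (map (x *_) xs)
  products-of-powers = trans (sym (map-∘ xs))
    (trans (map-cong (λ y → sym (^-distrib-* x y e)) xs) (map-∘ xs))

pairProducts-↭⇒powerSums-≡ : ∀ {xs ys} → pairProducts xs ↭ pairProducts ys → sum xs ≡ sum ys →
                             ∀ m → powerSum (2 ^ m) xs ≡ powerSum (2 ^ m) ys
pairProducts-↭⇒powerSums-≡ {xs} {ys} pp Σ≡ zero    =
  trans (powerSum-1 xs) (trans Σ≡ (sym (powerSum-1 ys)))
pairProducts-↭⇒powerSums-≡ {xs} {ys} pp Σ≡ (suc m) = begin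
  powerSum (2 ^ suc m) xs ≡⟨ powerSum-map-^ 2 (2 ^ m) xs ⟨
  powerSum (2 ^ m) xs²    ≡⟨ pairProducts-↭⇒powerSums-≡ {xs²} {ys²} pp² Σ²≡ m ⟩
  powerSum (2 ^ m) ys²    ≡⟨ powerSum-map-^ 2 (2 ^ m) ys ⟩
  powerSum (2 ^ suc m) ys ∎
  where
  open ≡-Reasoning
  xs² = map (_^ 2) xs
  ys² = map (_^ 2) ys
  pp² : pairProducts xs² ↭ pairProducts ys²
  pp² = subst₂ _↭_ (sym (pairProducts-map-^ 2 xs)) (sym (pairProducts-map-^ 2 ys))
                   (Perm.map⁺ (_^ 2) pp)
  Σ²≡ : powerSum 2 xs ≡ powerSum 2 ys
  Σ²≡ = +-cancelʳ-≡ (2 * sum (pairProducts xs)) _ _ (begin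
    powerSum 2 xs + 2 * sum (pairProducts xs) ≡⟨ sum²≡powerSum-2+2*sum-pairProducts xs ⟨
    sum xs ^ 2                                ≡⟨ cong (_^ 2) Σ≡ ⟩
    sum ys ^ 2                                ≡⟨ sum²≡powerSum-2+2*sum-pairProducts ys ⟩
    powerSum 2 ys + 2 * sum (pairProducts ys) ≡⟨ cong (λ t → powerSum 2 ys + 2 * t) (sum-↭ pp) ⟨
    powerSum 2 ys + 2 * sum (pairProducts xs) ∎)

module Sort = InsertionSort (Flip.decTotalOrder ≤-decTotalOrder)

pre2↭pairProducts : ∀ xs → pre2 xs ↭ pairProducts xs
pre2↭pairProducts xs = Sort.sort-↭ (pairProducts xs)

pre2-injective : ∀ {n xs ys} → IsBinPartition n xs → IsBinPartition n ys →
                 pre2 xs ≡ pre2 ys → xs ≡ ys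
pre2-injective {xs = xs} {ys} ((≥xs , _ , Σxs) , pxs) ((≥ys , _ , Σys) , pys) pre2≡ =
  decreasing-pow2-powerSums-injective ≥xs ≥ys pxs pys
    (pairProducts-↭⇒powerSums-≡ {xs} {ys} pp↭ (trans Σxs (sym Σys)))
  where
  pp↭ : pairProducts xs ↭ pairProducts ys
  pp↭ = ↭-trans (↭-sym (pre2↭pairProducts xs))
                (subst (_↭ pairProducts ys) (sym pre2≡) (pre2↭pairProducts ys))

indicator : {P : Set} → Dec P → ℕ
indicator P? = if does P? then 1 else 0

indicator-cong : ∀ {P Q : Set} → P ⇔ Q → (P? : Dec P) (Q? : Dec Q) → indicator P? ≡ indicator Q?
indicator-cong P⇔Q (yes _) (yes _) = refl
indicator-cong P⇔Q (yes p) (no ¬q) = ⊥-elim (¬q (Equivalence.to P⇔Q p))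
indicator-cong P⇔Q (no ¬p) (yes q) = ⊥-elim (¬p (Equivalence.from P⇔Q q))
indicator-cong P⇔Q (no _)  (no _)  = refl

indicator-no : ∀ {P : Set} (P? : Dec P) → ¬ P → indicator P? ≡ 0
indicator-no (yes p) ¬p = ⊥-elim (¬p p)
indicator-no (no _)  _  = refl

length-filter≡sum-indicator : ∀ {A : Set} {P : A → Set} (P? : Decidable P) xs →
                              length (filter P? xs) ≡ sum (map (indicator ∘ P?) xs)
length-filter≡sum-indicator P? []       = refl
length-filter≡sum-indicator P? (x ∷ xs) with P? x
... | yes _ = cong suc (length-filter≡sum-indicator P? xs)
... | no _  = length-filter≡sum-indicator P? xs

sum-applyUpTo-indicator-≟ : ∀ {j N} → j < N → sum (applyUpTo (λ i → indicator (i ≟ j)) N) ≡ 1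
sum-applyUpTo-indicator-≟ {zero}  {suc N} _         =
  cong suc (sum-zero (Allₚ.applyUpTo⁺₂ _ N (λ _ → refl)))
sum-applyUpTo-indicator-≟ {suc j} {suc N} (s<s j<N) = sum-applyUpTo-indicator-≟ j<N

sumTo-indicator-≟ : ∀ {j m} → j ≤ m → sumTo m (λ i → indicator (i ≟ j)) ≡ 1
sumTo-indicator-≟ {m = m} j≤m =
  trans (cong sum (map-upTo _ (suc m))) (sum-applyUpTo-indicator-≟ (s≤s j≤m))

≤⌊n/2⌋⇒≤n∸ : ∀ {i n} → i ≤ ⌊ n /2⌋ → i ≤ n ∸ i
≤⌊n/2⌋⇒≤n∸ {i} {n} i≤ = m+n≤o⇒m≤o∸n i (begin
  i + i             ≤⟨ +-mono-≤ i≤ (≤-trans i≤ (⌊n/2⌋≤⌈n/2⌉ n)) ⟩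
  ⌊ n /2⌋ + ⌈ n /2⌉ ≡⟨ ⌊n/2⌋+⌈n/2⌉≡n n ⟩
  n                 ∎)
  where open ≤-Reasoning

m⊓n≤⌊m+n/2⌋ : ∀ m n → m ⊓ n ≤ ⌊ (m + n) /2⌋
m⊓n≤⌊m+n/2⌋ m n = subst (_≤ ⌊ (m + n) /2⌋) (sym (n≡⌊n+n/2⌋ (m ⊓ n)))
                        (⌊n/2⌋-mono (+-mono-≤ (m⊓n≤m m n) (m⊓n≤n m n)))

RootMatch⇒*≡ : ∀ {e f a b} → RootMatch e f (a , b) → a * b ≡ e * f
RootMatch⇒*≡         (inj₁ (refl , refl)) = refl
RootMatch⇒*≡ {e} {f} (inj₂ (refl , refl)) = *-comm f e

RootMatch-2^-⊓ : ∀ p q → RootMatch (2 ^ (p ⊓ q)) (2 ^ (p + q ∸ p ⊓ q)) (2 ^ p , 2 ^ q)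
RootMatch-2^-⊓ p q with ≤-total p q
... | inj₁ p≤q = inj₁ (cong (2 ^_) (sym ⊓≡p) , cong (2 ^_) (sym q≡))
  where
  ⊓≡p = m≤n⇒m⊓n≡m p≤q
  q≡  = trans (cong (p + q ∸_) ⊓≡p) (m+n∸m≡n p q)
... | inj₂ q≤p = inj₂ (cong (2 ^_) (sym p≡) , cong (2 ^_) (sym ⊓≡q))
  where
  ⊓≡q = m≥n⇒m⊓n≡n q≤p
  p≡  = trans (cong (p + q ∸_) ⊓≡q) (m+n∸n≡m p q)

RootMatch-2^⇔ : ∀ {i p q} → i ≤ ⌊ (p + q) /2⌋ →
                RootMatch (2 ^ i) (2 ^ (p + q ∸ i)) (2 ^ p , 2 ^ q) ⇔ i ≡ p ⊓ q
RootMatch-2^⇔ {i} {p} {q} i≤ = mk⇔ to from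
  where
  i≤p+q∸i = ≤⌊n/2⌋⇒≤n∸ i≤
  to : RootMatch (2 ^ i) (2 ^ (p + q ∸ i)) (2 ^ p , 2 ^ q) → i ≡ p ⊓ q
  to (inj₁ (2^p≡2^i , 2^q≡)) =
    trans (sym p≡i) (sym (m≤n⇒m⊓n≡m (subst₂ _≤_ (sym p≡i) (sym (2^-injective 2^q≡)) i≤p+q∸i)))
    where p≡i = 2^-injective 2^p≡2^i
  to (inj₂ (2^p≡ , 2^q≡2^i)) =
    trans (sym q≡i) (sym (m≥n⇒m⊓n≡n (subst₂ _≤_ (sym q≡i) (sym (2^-injective 2^p≡)) i≤p+q∸i)))
    where q≡i = 2^-injective 2^q≡2^i
  from : i ≡ p ⊓ q → RootMatch (2 ^ i) (2 ^ (p + q ∸ i)) (2 ^ p , 2 ^ q)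
  from i≡ = subst (λ j → RootMatch (2 ^ j) (2 ^ (p + q ∸ j)) (2 ^ p , 2 ^ q)) (sym i≡)
                  (RootMatch-2^-⊓ p q)

rootMatches : ℕ → ℕ × ℕ → ℕ
rootMatches k ab = sumTo ⌊ k /2⌋ (λ i → indicator (rootMatch? (2 ^ i) (2 ^ (k ∸ i)) ab))

rootMatches-≢ : ∀ k {a b} → a * b ≢ 2 ^ k → rootMatches k (a , b) ≡ 0
rootMatches-≢ k {a} {b} ab≢2^k =
  sum-zero (Allₚ.map⁺ (Allₚ.applyUpTo⁺₁ id (suc ⌊ k /2⌋) no-match))
  where
  no-match : ∀ {i} → i < suc ⌊ k /2⌋ → indicator (rootMatch? (2 ^ i) (2 ^ (k ∸ i)) (a , b)) ≡ 0
  no-match {i} (s≤s i≤) = indicator-no (rootMatch? (2 ^ i) (2 ^ (k ∸ i)) (a , b))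
    (λ match → ab≢2^k (trans (RootMatch⇒*≡ {2 ^ i} {2 ^ (k ∸ i)} match) 2^i*2^[k∸i]≡2^k))
    where
    2^i*2^[k∸i]≡2^k : 2 ^ i * 2 ^ (k ∸ i) ≡ 2 ^ k
    2^i*2^[k∸i]≡2^k = trans (sym (^-distribˡ-+-* 2 i (k ∸ i)))
                            (cong (2 ^_) (m+[n∸m]≡n (≤-trans i≤ (⌊n/2⌋≤n k))))

rootMatches-≡1 : ∀ {k a b} → IsPow2 a → IsPow2 b → a * b ≡ 2 ^ k → rootMatches k (a , b) ≡ 1
rootMatches-≡1 {k} (p , refl) (q , refl) ab≡2^k
  with refl ← 2^-injective {p + q} {k} (trans (^-distribˡ-+-* 2 p q) ab≡2^k) = begin
  rootMatches (p + q) (2 ^ p , 2 ^ q)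
    ≡⟨ cong sum (map-cong-local (Allₚ.applyUpTo⁺₁ id _ match⇔≡⊓)) ⟩
  sumTo ⌊ (p + q) /2⌋ (λ i → indicator (i ≟ p ⊓ q))
    ≡⟨ sumTo-indicator-≟ (m⊓n≤⌊m+n/2⌋ p q) ⟩
  1 ∎
  where
  open ≡-Reasoning
  match⇔≡⊓ : ∀ {i} → i < suc ⌊ (p + q) /2⌋ →
             indicator (rootMatch? (2 ^ i) (2 ^ (p + q ∸ i)) (2 ^ p , 2 ^ q))
               ≡ indicator (i ≟ p ⊓ q)
  match⇔≡⊓ {i} (s≤s i≤) = indicator-cong (RootMatch-2^⇔ i≤) (rootMatch? _ _ _) (i ≟ p ⊓ q)

indicator-2^-product : ∀ k {a b} → IsPow2 a → IsPow2 b →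
                       indicator (a * b ≟ 2 ^ k) ≡ rootMatches k (a , b)
indicator-2^-product k {a} {b} pa pb = by-cases (a * b ≟ 2 ^ k)
  where
  by-cases : (ab≟2^k : Dec (a * b ≡ 2 ^ k)) → indicator ab≟2^k ≡ rootMatches k (a , b)
  by-cases (yes ab≡2^k) = sym (rootMatches-≡1 {k} pa pb ab≡2^k)
  by-cases (no ab≢2^k)  = sym (rootMatches-≢ k {a} {b} ab≢2^k)

mult-↭ : ∀ j {xs ys} → xs ↭ ys → mult j xs ≡ mult j ys
mult-↭ j xs↭ys = Perm.↭-length (Perm.filter-↭ (_≟ j) xs↭ys)

pairProducts≡map-*-posPairs : ∀ xs → pairProducts xs ≡ map (uncurry _*_) (posPairs xs)
pairProducts≡map-*-posPairs []       = refl
pairProducts≡map-*-posPairs (x ∷ xs) =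
  trans (cong₂ _++_ (map-∘ xs) (pairProducts≡map-*-posPairs xs))
        (sym (map-++ (uncurry _*_) (map (x ,_) xs) (posPairs xs)))

All-posPairs : ∀ {P : ℕ → Set} {xs} → All P xs →
               All (λ ab → P (proj₁ ab) × P (proj₂ ab)) (posPairs xs)
All-posPairs []         = []
All-posPairs (px ∷ pxs) = Allₚ.++⁺ (Allₚ.map⁺ (All.map (px ,_) pxs)) (All-posPairs pxs)

mult-2^-pre2 : ∀ k {xs} → All IsPow2 xs →
               mult (2 ^ k) (pre2 xs) ≡ sumTo ⌊ k /2⌋ (λ i → rootCount (2 ^ i) (2 ^ (k ∸ i)) xs)
mult-2^-pre2 k {xs} pxs = begin
  mult (2 ^ k) (pre2 xs)
    ≡⟨ mult-↭ (2 ^ k) (pre2↭pairProducts xs) ⟩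
  mult (2 ^ k) (pairProducts xs)
    ≡⟨ cong (mult (2 ^ k)) (pairProducts≡map-*-posPairs xs) ⟩
  mult (2 ^ k) (map (uncurry _*_) ps)
    ≡⟨ length-filter≡sum-indicator (_≟ 2 ^ k) (map (uncurry _*_) ps) ⟩
  sum (map (indicator ∘ (_≟ 2 ^ k)) (map (uncurry _*_) ps))
    ≡⟨ cong sum (map-∘ ps) ⟨
  sum (map (λ ab → indicator (uncurry _*_ ab ≟ 2 ^ k)) ps)
    ≡⟨ cong sum (map-cong-local (All.map (uncurry (indicator-2^-product k)) (All-posPairs pxs))) ⟩
  sum (map (rootMatches k) ps)
    ≡⟨ sum-map-comm (flip match) ps range ⟩
  sumTo ⌊ k /2⌋ (λ i → sum (map (match i) ps))
    ≡⟨ cong sum (map-cong (λ i → sym (length-filter≡sum-indicator (root? i) ps)) range) ⟩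
  sumTo ⌊ k /2⌋ (λ i → rootCount (2 ^ i) (2 ^ (k ∸ i)) xs) ∎
  where
  open ≡-Reasoning
  ps = posPairs xs
  range = upTo (suc ⌊ k /2⌋)
  root? : (i : ℕ) → Decidable (RootMatch (2 ^ i) (2 ^ (k ∸ i)))
  root? i = rootMatch? (2 ^ i) (2 ^ (k ∸ i))
  match : ℕ → ℕ × ℕ → ℕ
  match i = indicator ∘ root? i

has-two-parts? : (xs : List ℕ) → Dec (2 ≤ length xs)
has-two-parts? xs = 2 ≤? length xs

mult-pre2-short : ∀ j xs → ¬ 2 ≤ length xs → mult j (pre2 xs) ≡ 0
mult-pre2-short j []          _   = refl
mult-pre2-short j (_ ∷ [])    _   = refl
mult-pre2-short j (_ ∷ _ ∷ _) ¬2≤ = ⊥-elim (¬2≤ (s≤s (s≤s z≤n)))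

image-↭-map-pre2 : ∀ {n Im B} → Enumerates (InImB2 n) Im → Enumerates (IsBinPartition n) B →
                   Im ↭ map pre2 (filter has-two-parts? B)
image-↭-map-pre2 {n} {Im} {B} (Im! , ∈Im⇔) enumB@(B! , ∈B⇔) =
  ∼bag⇒↭ (unique∧set⇒bag Im! pre2[B₂]! (mk⇔ to from))
  where
  B₂ = filter has-two-parts? B
  B₂-binary : All (IsBinPartition n) B₂
  B₂-binary = Allₚ.filter⁺ has-two-parts? (Enumerates⇒All enumB)
  pre2[B₂]! : Unique (map pre2 B₂)
  pre2[B₂]! = Unique-map⁺-on pre2 pre2-injective B₂-binary (Uniqueₚ.filter⁺ has-two-parts? B!)
  to : ∀ {μ} → μ ∈ Im → μ ∈ map pre2 B₂
  to μ∈Im with Equivalence.to (∈Im⇔ _) μ∈Im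
  ... | xs , binary , two , refl =
    ∈-map⁺ pre2 (∈-filter⁺ has-two-parts? (Equivalence.from (∈B⇔ xs) binary) two)
  from : ∀ {μ} → μ ∈ map pre2 B₂ → μ ∈ Im
  from μ∈ with ∈-map⁻ pre2 μ∈
  ... | xs , xs∈B₂ , refl = Equivalence.from (∈Im⇔ _)
    (xs , All.lookup B₂-binary xs∈B₂ , proj₂ (∈-filter⁻ has-two-parts? {xs = B} xs∈B₂) , refl)

lemma2p1 : (n k : ℕ) (Im B : List (List ℕ)) →
           Enumerates (InImB2 n) Im →
           Enumerates (IsBinPartition n) B →
           sum (map (mult (2 ^ k)) Im)
             ≡ sumTo ⌊ k /2⌋ (λ i → sum (map (rootCount (2 ^ i) (2 ^ (k ∸ i))) B))
lemma2p1 n k Im B enumIm enumB = begin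
  sum (map (mult (2 ^ k)) Im)
    ≡⟨ sum-↭ (Perm.map⁺ (mult (2 ^ k)) (image-↭-map-pre2 enumIm enumB)) ⟩
  sum (map (mult (2 ^ k)) (map pre2 B₂))
    ≡⟨ cong sum (map-∘ B₂) ⟨
  sum (map (mult (2 ^ k) ∘ pre2) B₂)
    ≡⟨ sum-map-filter has-two-parts? (mult (2 ^ k) ∘ pre2) (mult-pre2-short (2 ^ k)) B ⟩
  sum (map (mult (2 ^ k) ∘ pre2) B)
    ≡⟨ cong sum (map-cong-local (All.map (mult-2^-pre2 k ∘ proj₂) (Enumerates⇒All enumB))) ⟩
  sum (map (λ xs → sumTo ⌊ k /2⌋ (λ i → roots i xs)) B)
    ≡⟨ sum-map-comm (flip roots) B (upTo (suc ⌊ k /2⌋)) ⟩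
  sumTo ⌊ k /2⌋ (λ i → sum (map (roots i) B)) ∎
  where
  open ≡-Reasoning
  B₂ = filter has-two-parts? B
  roots : ℕ → List ℕ → ℕ
  roots i = rootCount (2 ^ i) (2 ^ (k ∸ i))
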